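{- Let $K$ be a cubic field with fundamental discriminant $d_K$ in which $3$ ramifies, and let $F(x,y)=F_K(x,y)=(a,b,c,d)$ be an associated binary cubic form. Define $$f_K(x,y)=\begin{cases}\frac13F(x,3y)&\text{if } b\equiv0\pmod 3,\\ \frac13F(3x,y)&\text{if } c\equiv 0\pmod 3,\\ \frac13F(x,3(y-x))&\text{if } b\equiv -c\pmod 3,\\ \frac13F(x,3(y+x))&\text{if } b\equiv c\pmod 3.\end{cases}$$ Then $\phi_1$ sends the $\mathrm{SL}_2(\mathbb{Z})$-class of $f_K$ in $\mathrm{Cl}(\mathrm{Sym}^3\mathbb{Z}^2;-\frac{d_K}{3})$ to the $\mathrm{SL}_2(\mathbb{Z})$-class of $\frac16 q_K$ in $\mathrm{Cl}^+_{\mathbb{Q}(\sqrt{ -d_K/3})}[3]$, where $\frac16 q_K$ is the form $x\mapsto \frac16\mathrm{tr}_{K/\mathbb{Q}}(x^2)$ on $O_K^0$ in the $\mathbb{Z}$-basis $\{\alpha_0,3\beta_0\}$ if $b\equiv 0$, $\{3\alpha_0,\beta_0\}$ if $c\equiv0$, $\{\alpha_0-\beta_0,3\beta_0\}$ if $b\equiv-c$, $\{\alpha_0+\beta_0,3\beta_0\}$ if $b\equiv c\pmod 3$.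
   Context: A fundamental discriminant is the discriminant of a quadratic field. $(a,b,c,d)$ denotes $ax^3+bx^2y+cxy^2+dy^3$. By Delone–Faddeev, $K$ has an associated integral binary cubic form $F_K=(a,b,c,d)$ (unique up to $\mathrm{GL}_2(\mathbb{Z})$) with discriminant $d_K$ such that for a root $\theta$ of $F_K(x,1)$, $K=\mathbb{Q}(\theta)$ and $\{1,-a\theta,d/\theta\}$ is a $\mathbb{Z}$-basis of $O_K$; $\alpha=-a\theta$, $\beta=d/\theta$, $\alpha_0=\alpha-\mathrm{tr}(\alpha)/3$, $\beta_0=\beta-\mathrm{tr}(\beta)/3$, $O_K^0=\{x\in O_K:\mathrm{tr}_{K/\mathbb{Q}}(x)=0\}$. A Gaussian cubic form is an integral binary cubic form $(a_0,3a_1,3a_2,a_3)$ with $a_i\in\mathbb{Z}$. $\mathrm{Cl}(\mathrm{Sym}^3\mathbb{Z}^2;\Delta)$ is the set of $\mathrm{SL}_2(\mathbb{Z})$-classes of Gaussian cubic forms whose associated triply symmetric cube (entries $a_{ijk}=a_{i+j+k}$) has discriminant $\Delta$; the cube discriminant equals $-D/27$ where $D$ is the discriminant of the cubic form. The map $\phi_1$ (Bhargava) sends the class of $(a_0,3a_1,3a_2,a_3)$ to the $\mathrm{SL}_2(\mathbb{Z})$-class of the binary quadratic form $(a_1^2-a_0a_2)x^2+(a_1a_2-a_0a_3)xy+(a_2^2-a_1a_3)y^2$, an element of the $3$-torsion of the narrow class group $\mathrm{Cl}^+_{\mathbb{Q}(\sqrt\Delta)}$ (identified with $\mathrm{SL}_2(\mathbb{Z})$-classes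 of primitive forms of discriminant $\Delta$ under Gauss composition). -}

module Defs where

open import Data.Nat using (ℕ)
open import Data.Integer as ℤ using (ℤ; +_; -[1+_])
open import Data.Integer.Divisibility using (_∣_)
open import Data.Rational as ℚ using (ℚ)
open import Data.Product using (Σ; ∃; _×_; _,_)
open import Data.Sum using (_⊎_)
open import Relation.Binary.PropositionalEquality using (_≡_; _≢_)
open import Relation.Nullary using (¬_)

cubicForm : (a b c d x y : ℤ) → ℤ
cubicForm a b c d x y =
  a ℤ.* (x ℤ.* x ℤ.* x) ℤ.+ b ℤ.* (x ℤ.* x ℤ.* y)
    ℤ.+ c ℤ.* (x ℤ.* y ℤ.* y) ℤ.+ d ℤ.* (y ℤ.* y ℤ.* y)

disc : (a b c d : ℤ) → ℤ
disc a b c d =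
  b ℤ.* b ℤ.* c ℤ.* c ℤ.- + 4 ℤ.* a ℤ.* c ℤ.* c ℤ.* c
    ℤ.- + 4 ℤ.* b ℤ.* b ℤ.* b ℤ.* d ℤ.- + 27 ℤ.* a ℤ.* a ℤ.* d ℤ.* d
    ℤ.+ + 18 ℤ.* a ℤ.* b ℤ.* c ℤ.* d

cubicFormℚ : (a b c d : ℤ) (x y : ℚ) → ℚ
cubicFormℚ a b c d x y =
  (a ℚ./ 1) ℚ.* (x ℚ.* x ℚ.* x) ℚ.+ (b ℚ./ 1) ℚ.* (x ℚ.* x ℚ.* y)
    ℚ.+ (c ℚ./ 1) ℚ.* (x ℚ.* y ℚ.* y) ℚ.+ (d ℚ./ 1) ℚ.* (y ℚ.* y ℚ.* y)

Irreducible : (a b c d : ℤ) → Set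
Irreducible a b c d =
  ¬ (Σ ℚ λ p → Σ ℚ λ q → Σ ℚ λ r → Σ ℚ λ s → Σ ℚ λ t →
       ∀ (x y : ℚ) → cubicFormℚ a b c d x y
         ≡ (p ℚ.* x ℚ.+ q ℚ.* y) ℚ.* (r ℚ.* x ℚ.* x ℚ.+ s ℚ.* x ℚ.* y ℚ.+ t ℚ.* y ℚ.* y))

Squarefree : ℤ → Set
Squarefree m = ∀ (k : ℤ) → (k ℤ.* k) ∣ m → ℤ.∣ k ∣ ≡ 1

FundamentalDiscriminant : ℤ → Set
FundamentalDiscriminant D =
  (D ≢ + 1 × (+ 4) ∣ (D ℤ.- + 1) × Squarefree D)
  ⊎ (Σ ℤ λ m → D ≡ + 4 ℤ.* m × ((+ 4) ∣ (m ℤ.- + 2) ⊎ (+ 4) ∣ (m ℤ.- + 3)) × Squarefree m)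

-- The cubic field K = ℚ ⊗ O_K, with O_K = ℤ·1 ⊕ ℤ·α ⊕ ℤ·β,
-- α = −aθ, β = d/θ, θ a root of F(x,1).  From aθ³+bθ²+cθ+d = 0 one gets
--   αβ = −ad,  α² = −ac + bα − aβ,  β² = −bd + dα − cβ.
-- Elements are coordinate triples ⟨ r , s , t ⟩ = r + sα + tβ (r,s,t ∈ ℚ).

record K3 : Set where
  constructor ⟨_,_,_⟩
  field
    c₀ c₁ c₂ : ℚ
open K3 public

module Field (a b c d : ℤ) where
  private
    A B C D : ℚ
    A = a ℚ./ 1
    B = b ℚ./ 1
    C = c ℚ./ 1
    D = d ℚ./ 1

  one αK βK : K3
  one = ⟨ ℚ.1ℚ , ℚ.0ℚ , ℚ.0ℚ ⟩
  αK  = ⟨ ℚ.0ℚ , ℚ.1ℚ , ℚ.0ℚ ⟩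
  βK  = ⟨ ℚ.0ℚ , ℚ.0ℚ , ℚ.1ℚ ⟩

  infixl 6 _⊕_
  infixr 7 _·_
  _⊕_ : K3 → K3 → K3
  ⟨ r , s , t ⟩ ⊕ ⟨ r' , s' , t' ⟩ = ⟨ r ℚ.+ r' , s ℚ.+ s' , t ℚ.+ t' ⟩

  _·_ : ℚ → K3 → K3
  q · ⟨ r , s , t ⟩ = ⟨ q ℚ.* r , q ℚ.* s , q ℚ.* t ⟩

  _⊗_ : K3 → K3 → K3
  ⟨ r , s , t ⟩ ⊗ ⟨ r' , s' , t' ⟩ =
    ⟨ r ℚ.* r' ℚ.- A ℚ.* C ℚ.* (s ℚ.* s') ℚ.- A ℚ.* D ℚ.* (s ℚ.* t' ℚ.+ t ℚ.* s')
        ℚ.- B ℚ.* D ℚ.* (t ℚ.* t')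
    , r ℚ.* s' ℚ.+ s ℚ.* r' ℚ.+ B ℚ.* (s ℚ.* s') ℚ.+ D ℚ.* (t ℚ.* t')
    , r ℚ.* t' ℚ.+ t ℚ.* r' ℚ.- A ℚ.* (s ℚ.* s') ℚ.- C ℚ.* (t ℚ.* t') ⟩

  -- tr_{K/ℚ}(x): trace of the ℚ-linear map y ↦ x y in the basis {1, α, β}
  tr : K3 → ℚ
  tr x = c₀ (x ⊗ one) ℚ.+ c₁ (x ⊗ αK) ℚ.+ c₂ (x ⊗ βK)

  α₀ β₀ : K3
  α₀ = αK ⊕ (ℚ.- (tr αK ℚ.* (+ 1 ℚ./ 3))) · one
  β₀ = βK ⊕ (ℚ.- (tr βK ℚ.* (+ 1 ℚ./ 3))) · one

data Case : Set where
  b≡0 c≡0 b≡-c b≡c : Case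

CaseCond : Case → ℤ → ℤ → Set
CaseCond b≡0  b c = (+ 3) ∣ b
CaseCond c≡0  b c = (+ 3) ∣ c
CaseCond b≡-c b c = (+ 3) ∣ (b ℤ.+ c)
CaseCond b≡c  b c = (+ 3) ∣ (b ℤ.- c)

substX substY : Case → ℤ → ℤ → ℤ
substX b≡0  x y = x
substX c≡0  x y = + 3 ℤ.* x
substX b≡-c x y = x
substX b≡c  x y = x
substY b≡0  x y = + 3 ℤ.* y
substY c≡0  x y = y
substY b≡-c x y = + 3 ℤ.* y ℤ.- x
substY b≡c  x y = + 3 ℤ.* y ℤ.+ x

basis₁ basis₂ : (a b c d : ℤ) → Case → K3
basis₁ a b c d b≡0  = Field.α₀ a b c d
basis₁ a b c d c≡0  = Field._·_ a b c d (+ 3 ℚ./ 1) (Field.α₀ a b c d)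
basis₁ a b c d b≡-c = Field._⊕_ a b c d (Field.α₀ a b c d)
                        (Field._·_ a b c d (ℚ.- ℚ.1ℚ) (Field.β₀ a b c d))
basis₁ a b c d b≡c  = Field._⊕_ a b c d (Field.α₀ a b c d) (Field.β₀ a b c d)
basis₂ a b c d b≡0  = Field._·_ a b c d (+ 3 ℚ./ 1) (Field.β₀ a b c d)
basis₂ a b c d c≡0  = Field.β₀ a b c d
basis₂ a b c d b≡-c = Field._·_ a b c d (+ 3 ℚ./ 1) (Field.β₀ a b c d)
basis₂ a b c d b≡c  = Field._·_ a b c d (+ 3 ℚ./ 1) (Field.β₀ a b c d)

sixthTraceForm : (a b c d : ℤ) → Case → ℤ → ℤ → ℚ
sixthTraceForm a b c d k x y =
  tr (v ⊗ v) ℚ.* (+ 1 ℚ./ 6)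
  where
    open Field a b c d
    v : K3
    v = ((x ℚ./ 1) · basis₁ a b c d k) ⊕ ((y ℚ./ 1) · basis₂ a b c d k)

gaussianForm : (a₀ a₁ a₂ a₃ x y : ℤ) → ℤ
gaussianForm a₀ a₁ a₂ a₃ = cubicForm a₀ (+ 3 ℤ.* a₁) (+ 3 ℤ.* a₂) a₃

quadForm : (A B C x y : ℤ) → ℤ
quadForm A B C x y = A ℤ.* (x ℤ.* x) ℤ.+ B ℤ.* (x ℤ.* y) ℤ.+ C ℤ.* (y ℤ.* y)

φ₁ : (a₀ a₁ a₂ a₃ x y : ℤ) → ℤ
φ₁ a₀ a₁ a₂ a₃ =
  quadForm (a₁ ℤ.* a₁ ℤ.- a₀ ℤ.* a₂) (a₁ ℤ.* a₂ ℤ.- a₀ ℤ.* a₃) (a₂ ℤ.* a₂ ℤ.- a₁ ℤ.* a₃)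

SL₂-equivalent : (ℤ → ℤ → ℤ) → (ℤ → ℤ → ℚ) → Set
SL₂-equivalent Φ g =
  Σ ℤ λ p → Σ ℤ λ q → Σ ℤ λ r → Σ ℤ λ s →
    (p ℤ.* s ℤ.- q ℤ.* r ≡ + 1) ×
    (∀ (x y : ℤ) → g x y ≡ (Φ (p ℤ.* x ℤ.+ q ℤ.* y) (r ℤ.* x ℤ.+ s ℤ.* y) ℚ./ 1))

{-# OPTIONS --safe #-}
-- A unimodular change of variables, namely the identity, the swap x ↔ y or a shear
-- y ↦ y ∓ x according to the case, takes F to a form G with the same discriminant and
-- 3 ∣ b(G).  Then disc G ≡ −a(G) c(G)³ (mod 3), and 3 ∣ c(G) would give 9 ∣ d_K, which
-- is impossible for a fundamental discriminant; as 3 ∣ d_K, it follows that 3 ∣ a(G),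
-- so G = (3p₀, 3p₁, p₂, p₃).  In these parameters f_K(x, y) = G(x, 3y)/3 (with x and y
-- swapped when 3 ∣ c) is an explicit Gaussian form, and the three claims (3 f_K is F
-- after the substitution, disc f_K = 9 d_K, and φ₁(f_K) = q_K/6 with the identity as
-- SL₂(ℤ)-matrix) are polynomial identities in p₀, …, p₃, x, y, checked by the ring solver.
module Submission where

open import Defs
open import Level using (0ℓ)
open import Function using (id)
open import Data.Nat using (ℕ; suc)
open import Data.Nat.Divisibility using () renaming (_∣_ to _ℕ∣_)
open import Data.Nat.Primality using (Prime; prime?; euclidsLemma)
open import Data.Integer as ℤ using (ℤ; +_)
import Data.Integer.Properties as ℤP
open import Data.Integer.Divisibility using (_∣_)
open import Data.Integer.Divisibility.Signed
  using (divides; ∣ᵤ⇒∣; ∣⇒∣ᵤ; ∣m∣n⇒∣m+n; ∣m+n∣m⇒∣n) renaming (_∣_ to _∣ₛ_)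
open import Data.Rational as ℚ using (ℚ)
import Data.Rational.Properties as ℚP
open import Data.Rational.Unnormalised as ℚᵘ using (mkℚᵘ; *≡*)
import Data.Rational.Unnormalised.Properties as ℚᵘP
open import Data.Fin using (#_)
open import Data.Vec as Vec using (Vec; []; _∷_; lookup)
open import Data.Vec.Properties using (lookup-map)
open import Data.Product using (Σ; _×_; _,_)
open import Data.Sum as Sum using (_⊎_; inj₁; inj₂)
open import Data.Empty using (⊥-elim)
open import Data.Unit using (tt)
open import Relation.Nullary using (¬_)
open import Relation.Nullary.Decidable using (dec⇒maybe; toWitness)
open import Relation.Binary.PropositionalEquality
  using (_≡_; refl; sym; trans; cong; cong₂; subst; module ≡-Reasoning)
open import Algebra.Bundles using (RawRing)
open import Tactic.RingSolver.Core.AlmostCommutativeRing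
  using (AlmostCommutativeRing; fromCommutativeRing)
open import Tactic.RingSolver.Core.Expression
import Tactic.RingSolver.NonReflective as NonReflective
import Data.Integer.Tactic.RingSolver as ℤ-Solver

infixl 9 _[_]
_[_] : ∀ {A : Set} {m n} → Expr A m → Vec (Expr A n) m → Expr A n
Κ c     [ σ ] = Κ c
Ι i     [ σ ] = lookup σ i
(e ⊕ f) [ σ ] = e [ σ ] ⊕ f [ σ ]
(e ⊗ f) [ σ ] = e [ σ ] ⊗ f [ σ ]
(e ⊛ k) [ σ ] = e [ σ ] ⊛ k
(⊝ e)   [ σ ] = ⊝ e [ σ ]

module _ {ℓ₁ ℓ₂} (R : RawRing ℓ₁ ℓ₂) {A : Set} (⟦_⟧ᶜ : A → RawRing.Carrier R) where
  open RawRing R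
  open Eval R ⟦_⟧ᶜ
  open import Algebra.Definitions.RawSemiring rawSemiring using (_^′_)

  ⟦[]⟧ : ∀ {m n} (e : Expr A m) (σ : Vec (Expr A n) m) ρ →
         ⟦ e [ σ ] ⟧ ρ ≡ ⟦ e ⟧ (Vec.map (λ s → ⟦ s ⟧ ρ) σ)
  ⟦[]⟧ (Κ c)   σ ρ = refl
  ⟦[]⟧ (Ι i)   σ ρ = sym (lookup-map i (λ s → ⟦ s ⟧ ρ) σ)
  ⟦[]⟧ (e ⊕ f) σ ρ = cong₂ _+_ (⟦[]⟧ e σ ρ) (⟦[]⟧ f σ ρ)
  ⟦[]⟧ (e ⊗ f) σ ρ = cong₂ _*_ (⟦[]⟧ e σ ρ) (⟦[]⟧ f σ ρ)
  ⟦[]⟧ (e ⊛ k) σ ρ = cong (_^′ k) (⟦[]⟧ e σ ρ)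
  ⟦[]⟧ (⊝ e)   σ ρ = cong -_ (⟦[]⟧ e σ ρ)

ℚ-ring : AlmostCommutativeRing 0ℓ 0ℓ
ℚ-ring = fromCommutativeRing ℚP.+-*-commutativeRing λ q → dec⇒maybe (ℚ.0ℚ ℚ.≟ q)

module Sℤ = NonReflective ℤ-Solver.ring
module Sℚ = NonReflective ℚ-ring

open Sℤ.Ops using () renaming (⟦_⟧ to ⟦_⟧ℤ)
open Sℚ.Ops using () renaming (⟦_⟧ to ⟦_⟧ℚ)

⟦[]⟧ℤ : ∀ {m n} (e : Expr ℤ m) (σ : Vec (Expr ℤ n) m) ρ →
        ⟦ e [ σ ] ⟧ℤ ρ ≡ ⟦ e ⟧ℤ (Vec.map (λ s → ⟦ s ⟧ℤ ρ) σ)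
⟦[]⟧ℤ = ⟦[]⟧ (AlmostCommutativeRing.rawRing ℤ-Solver.ring) id

⟦[]⟧ℚ : ∀ {m n} (e : Expr ℚ m) (σ : Vec (Expr ℚ n) m) ρ →
        ⟦ e [ σ ] ⟧ℚ ρ ≡ ⟦ e ⟧ℚ (Vec.map (λ s → ⟦ s ⟧ℚ ρ) σ)
⟦[]⟧ℚ = ⟦[]⟧ (AlmostCommutativeRing.rawRing ℚ-ring) id

-- Polynomial identities in six variables, certified by comparing normal forms.  A record,
-- so that its two sides are never recovered by unfolding the normaliser.
module Identities (R : AlmostCommutativeRing 0ℓ 0ℓ) where
  open AlmostCommutativeRing R using (Carrier; _≈_)
  open NonReflective R using (module Ops)

  infix 4 _≐_
  record _≐_ (e e′ : Expr Carrier 6) : Set where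
    constructor by-normalisation
    field
      normal-forms : ∀ {x₀ x₁ x₂ x₃ x₄ x₅} →
        let ρ = x₀ ∷ x₁ ∷ x₂ ∷ x₃ ∷ x₄ ∷ x₅ ∷ [] in Ops.⟦ e ⇓⟧ ρ ≈ Ops.⟦ e′ ⇓⟧ ρ

  ≐-sound : ∀ {e e′} → e ≐ e′ → ∀ ρ → Ops.⟦ e ⟧ ρ ≈ Ops.⟦ e′ ⟧ ρ
  ≐-sound {e} {e′} (by-normalisation e≐e′) ρ@(x₀ ∷ x₁ ∷ x₂ ∷ x₃ ∷ x₄ ∷ x₅ ∷ []) =
    Ops.prove ρ e e′ (e≐e′ {x₀} {x₁} {x₂} {x₃} {x₄} {x₅})

open Identities ℤ-Solver.ring using ()
  renaming (_≐_ to _≐ℤ_; ≐-sound to ≐ℤ-sound; by-normalisation to ℤ-normalisation)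
open Identities ℚ-ring using ()
  renaming (_≐_ to _≐ℚ_; ≐-sound to ≐ℚ-sound; by-normalisation to ℚ-normalisation)

toℚ : ℤ → ℚ
toℚ n = n ℚ./ 1

private
  toℚᵘ-toℚ : ∀ n → ℚ.toℚᵘ (toℚ n) ℚᵘ.≃ mkℚᵘ n 0
  toℚᵘ-toℚ n = ℚP.toℚᵘ-fromℚᵘ (mkℚᵘ n 0)

toℚ-homo-+ : ∀ m n → toℚ (m ℤ.+ n) ≡ toℚ m ℚ.+ toℚ n
toℚ-homo-+ m n = ℚP.toℚᵘ-injective (begin
  ℚ.toℚᵘ (toℚ (m ℤ.+ n))              ≈⟨ toℚᵘ-toℚ (m ℤ.+ n) ⟩
  mkℚᵘ (m ℤ.+ n) 0                    ≈⟨ *≡* (cross-multiplied m n) ⟩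
  mkℚᵘ m 0 ℚᵘ.+ mkℚᵘ n 0              ≈⟨ ℚᵘP.+-cong (toℚᵘ-toℚ m) (toℚᵘ-toℚ n) ⟨
  ℚ.toℚᵘ (toℚ m) ℚᵘ.+ ℚ.toℚᵘ (toℚ n)  ≈⟨ ℚP.toℚᵘ-homo-+ (toℚ m) (toℚ n) ⟨
  ℚ.toℚᵘ (toℚ m ℚ.+ toℚ n)            ∎)
  where
  open ℚᵘP.≃-Reasoning
  cross-multiplied : ∀ m n → (m ℤ.+ n) ℤ.* (+ 1 ℤ.* + 1) ≡ (m ℤ.* + 1 ℤ.+ n ℤ.* + 1) ℤ.* + 1
  cross-multiplied = ℤ-Solver.solve-∀

toℚ-homo-* : ∀ m n → toℚ (m ℤ.* n) ≡ toℚ m ℚ.* toℚ n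
toℚ-homo-* m n = ℚP.toℚᵘ-injective (begin
  ℚ.toℚᵘ (toℚ (m ℤ.* n))              ≈⟨ toℚᵘ-toℚ (m ℤ.* n) ⟩
  mkℚᵘ (m ℤ.* n) 0                    ≈⟨ *≡* (cross-multiplied m n) ⟩
  mkℚᵘ m 0 ℚᵘ.* mkℚᵘ n 0              ≈⟨ ℚᵘP.*-cong (toℚᵘ-toℚ m) (toℚᵘ-toℚ n) ⟨
  ℚ.toℚᵘ (toℚ m) ℚᵘ.* ℚ.toℚᵘ (toℚ n)  ≈⟨ ℚP.toℚᵘ-homo-* (toℚ m) (toℚ n) ⟨
  ℚ.toℚᵘ (toℚ m ℚ.* toℚ n)            ∎)
  where
  open ℚᵘP.≃-Reasoning
  cross-multiplied : ∀ m n → (m ℤ.* n) ℤ.* (+ 1 ℤ.* + 1) ≡ (m ℤ.* n) ℤ.* + 1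
  cross-multiplied = ℤ-Solver.solve-∀

toℚ-homo‿- : ∀ n → toℚ (ℤ.- n) ≡ ℚ.- toℚ n
toℚ-homo‿- n = ℚP.toℚᵘ-injective (begin
  ℚ.toℚᵘ (toℚ (ℤ.- n))  ≈⟨ toℚᵘ-toℚ (ℤ.- n) ⟩
  mkℚᵘ (ℤ.- n) 0        ≈⟨ ℚᵘP.-‿cong (toℚᵘ-toℚ n) ⟨
  ℚᵘ.- ℚ.toℚᵘ (toℚ n)   ≈⟨ ℚP.toℚᵘ-homo‿- (toℚ n) ⟨
  ℚ.toℚᵘ (ℚ.- toℚ n)    ∎)
  where open ℚᵘP.≃-Reasoning

castExpr : ∀ {n} → Expr ℤ n → Expr ℚ n
castExpr (Κ c)   = Κ (toℚ c)
castExpr (Ι i)   = Ι i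
castExpr (e ⊕ f) = castExpr e ⊕ castExpr f
castExpr (e ⊗ f) = castExpr e ⊗ castExpr f
castExpr (e ⊛ k) = castExpr e ⊛ k
castExpr (⊝ e)   = ⊝ castExpr e

⟦castExpr⟧ : ∀ {n} (e : Expr ℤ n) ρ → ⟦ castExpr e ⟧ℚ (Vec.map toℚ ρ) ≡ toℚ (⟦ e ⟧ℤ ρ)
⟦castExpr⟧ (Κ c)   ρ = refl
⟦castExpr⟧ (Ι i)   ρ = lookup-map i toℚ ρ
⟦castExpr⟧ (e ⊕ f) ρ =
  trans (cong₂ ℚ._+_ (⟦castExpr⟧ e ρ) (⟦castExpr⟧ f ρ)) (sym (toℚ-homo-+ (⟦ e ⟧ℤ ρ) (⟦ f ⟧ℤ ρ)))
⟦castExpr⟧ (e ⊗ f) ρ =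
  trans (cong₂ ℚ._*_ (⟦castExpr⟧ e ρ) (⟦castExpr⟧ f ρ)) (sym (toℚ-homo-* (⟦ e ⟧ℤ ρ) (⟦ f ⟧ℤ ρ)))
⟦castExpr⟧ (⊝ e)   ρ = trans (cong ℚ.-_ (⟦castExpr⟧ e ρ)) (sym (toℚ-homo‿- (⟦ e ⟧ℤ ρ)))
⟦castExpr⟧ (e ⊛ k) ρ = power k
  where
  power : ∀ k → ⟦ castExpr e ⊛ k ⟧ℚ (Vec.map toℚ ρ) ≡ toℚ (⟦ e ⊛ k ⟧ℤ ρ)
  power 0             = refl
  power 1             = ⟦castExpr⟧ e ρ
  power (suc (suc k)) = trans (cong₂ ℚ._*_ (power (suc k)) (⟦castExpr⟧ e ρ))
                              (sym (toℚ-homo-* (⟦ e ⊛ suc k ⟧ℤ ρ) (⟦ e ⟧ℤ ρ)))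

⟦map-castExpr⟧ : ∀ {m n} (σ : Vec (Expr ℤ n) m) ρ →
  Vec.map (λ e → ⟦ e ⟧ℚ (Vec.map toℚ ρ)) (Vec.map castExpr σ)
    ≡ Vec.map toℚ (Vec.map (λ e → ⟦ e ⟧ℤ ρ) σ)
⟦map-castExpr⟧ []      ρ = refl
⟦map-castExpr⟧ (e ∷ σ) ρ = cong₂ _∷_ (⟦castExpr⟧ e ρ) (⟦map-castExpr⟧ σ ρ)

-- Each …E
-- evaluates, by computation, to the function it copies, so identities between the
-- latter can be handed to the ring solver.

record Cubic (A : Set) : Set where
  constructor cubic
  field a b c d : A

mapCubic : ∀ {A B : Set} → (A → B) → Cubic A → Cubic B
mapCubic f (cubic a b c d) = cubic (f a) (f b) (f c) (f d)

discriminant : Cubic ℤ → ℤ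
discriminant (cubic a b c d) = disc a b c d

module _ {A : Set} {n : ℕ} where
  infixl 6 _⊖_
  _⊖_ : Expr A n → Expr A n → Expr A n
  e ⊖ f = e ⊕ ⊝ f

  cubicE : Cubic (Expr A n) → (x y : Expr A n) → Expr A n
  cubicE (cubic a b c d) x y =
    a ⊗ (x ⊗ x ⊗ x) ⊕ b ⊗ (x ⊗ x ⊗ y) ⊕ c ⊗ (x ⊗ y ⊗ y) ⊕ d ⊗ (y ⊗ y ⊗ y)

  φ₁E : Cubic (Expr A n) → (x y : Expr A n) → Expr A n
  φ₁E (cubic a₀ a₁ a₂ a₃) x y =
    (a₁ ⊗ a₁ ⊖ a₀ ⊗ a₂) ⊗ (x ⊗ x) ⊕ (a₁ ⊗ a₂ ⊖ a₀ ⊗ a₃) ⊗ (x ⊗ y)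
      ⊕ (a₂ ⊗ a₂ ⊖ a₁ ⊗ a₃) ⊗ (y ⊗ y)

module _ {n : ℕ} where
  discE : Cubic (Expr ℤ n) → Expr ℤ n
  discE (cubic a b c d) =
    b ⊗ b ⊗ c ⊗ c ⊖ Κ (+ 4) ⊗ a ⊗ c ⊗ c ⊗ c
      ⊖ Κ (+ 4) ⊗ b ⊗ b ⊗ b ⊗ d ⊖ Κ (+ 27) ⊗ a ⊗ a ⊗ d ⊗ d
      ⊕ Κ (+ 18) ⊗ a ⊗ b ⊗ c ⊗ d

  gaussianCoefficients : Cubic (Expr ℤ n) → Cubic (Expr ℤ n)
  gaussianCoefficients (cubic a₀ a₁ a₂ a₃) = cubic a₀ (Κ (+ 3) ⊗ a₁) (Κ (+ 3) ⊗ a₂) a₃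

  substXE substYE : Case → (x y : Expr ℤ n) → Expr ℤ n
  substXE b≡0  x y = x
  substXE c≡0  x y = Κ (+ 3) ⊗ x
  substXE b≡-c x y = x
  substXE b≡c  x y = x
  substYE b≡0  x y = Κ (+ 3) ⊗ y
  substYE c≡0  x y = y
  substYE b≡-c x y = Κ (+ 3) ⊗ y ⊖ x
  substYE b≡c  x y = Κ (+ 3) ⊗ y ⊕ x

  shearE : Expr ℤ n → Cubic (Expr ℤ n) → Cubic (Expr ℤ n)
  shearE t (cubic a b c d) =
    cubic (a ⊕ b ⊗ t ⊕ c ⊗ (t ⊗ t) ⊕ d ⊗ (t ⊗ t ⊗ t))
          (b ⊕ Κ (+ 2) ⊗ c ⊗ t ⊕ Κ (+ 3) ⊗ d ⊗ (t ⊗ t))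
          (c ⊕ Κ (+ 3) ⊗ d ⊗ t)
          d

y₀ y₁ y₂ y₃ : ∀ {A : Set} → Expr A 4
y₀ = Ι (# 0)
y₁ = Ι (# 1)
y₂ = Ι (# 2)
y₃ = Ι (# 3)

x₀ x₁ x₂ x₃ x₄ x₅ : ∀ {A : Set} → Expr A 6
x₀ = Ι (# 0)
x₁ = Ι (# 1)
x₂ = Ι (# 2)
x₃ = Ι (# 3)
x₄ = Ι (# 4)
x₅ = Ι (# 5)

genericCubic : ∀ {A : Set} → Cubic (Expr A 6)
genericCubic = cubic x₀ x₁ x₂ x₃

reverse : ∀ {A : Set} → Cubic A → Cubic A
reverse (cubic a b c d) = cubic d c b a

-- Opaque: unfolding nested shears of a neutral form makes conversion checking blow up.
opaque
  shear : ℤ → Cubic ℤ → Cubic ℤ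
  shear t (cubic a b c d) =
    cubic (a ℤ.+ b ℤ.* t ℤ.+ c ℤ.* (t ℤ.* t) ℤ.+ d ℤ.* (t ℤ.* t ℤ.* t))
          (b ℤ.+ + 2 ℤ.* c ℤ.* t ℤ.+ + 3 ℤ.* d ℤ.* (t ℤ.* t))
          (c ℤ.+ + 3 ℤ.* d ℤ.* t)
          d

discriminant-reverse : ∀ F → discriminant (reverse F) ≡ discriminant F
discriminant-reverse (cubic a b c d) =
  Sℤ.solve 4 (λ a b c d → discE (reverse (cubic a b c d)) , discE (cubic a b c d)) refl a b c d

opaque
  unfolding shear

  discriminant-shear : ∀ t F → discriminant (shear t F) ≡ discriminant F
  discriminant-shear t (cubic a b c d) =
    Sℤ.solve 5 (λ t a b c d → discE (shearE t (cubic a b c d)) , discE (cubic a b c d)) refl t a b c d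

  shear-inverse : ∀ t F → shear (ℤ.- t) (shear t F) ≡ F
  shear-inverse t (cubic a b c d) =
    coefficientwise
      (Sℤ.solve 5 (λ t a b c d → Cubic.a (shearE (⊝ t) (shearE t (cubic a b c d))) , a) refl t a b c d)
      (Sℤ.solve 5 (λ t a b c d → Cubic.b (shearE (⊝ t) (shearE t (cubic a b c d))) , b) refl t a b c d)
      (Sℤ.solve 5 (λ t a b c d → Cubic.c (shearE (⊝ t) (shearE t (cubic a b c d))) , c) refl t a b c d)
    where
    coefficientwise : ∀ {a′ b′ c′} → a′ ≡ a → b′ ≡ b → c′ ≡ c → cubic a′ b′ c′ d ≡ cubic a b c d
    coefficientwise refl refl refl = refl

-- The shears are written so that expand-reduce is literally an instance of shear-inverse.
reduce expand : Case → Cubic ℤ → Cubic ℤ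
reduce b≡0  F = F
reduce c≡0  F = reverse F
reduce b≡-c F = shear ℤ.-1ℤ F
reduce b≡c  F = shear ℤ.1ℤ F
expand b≡0  F = F
expand c≡0  F = reverse F
expand b≡-c F = shear (ℤ.- ℤ.-1ℤ) F
expand b≡c  F = shear (ℤ.- ℤ.1ℤ) F

expand-reduce : ∀ k F → expand k (reduce k F) ≡ F
expand-reduce b≡0  F = refl
expand-reduce c≡0  F = refl
expand-reduce b≡-c F = shear-inverse ℤ.-1ℤ F
expand-reduce b≡c  F = shear-inverse ℤ.1ℤ F

discriminant-reduce : ∀ k F → discriminant (reduce k F) ≡ discriminant F
discriminant-reduce b≡0  F = refl
discriminant-reduce c≡0  F = discriminant-reverse F
discriminant-reduce b≡-c F = discriminant-shear ℤ.-1ℤ F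
discriminant-reduce b≡c  F = discriminant-shear ℤ.1ℤ F

opaque
  unfolding shear

  3∣b[reduce] : ∀ k {a b c d} → CaseCond k b c → + 3 ∣ₛ Cubic.b (reduce k (cubic a b c d))
  3∣b[reduce] b≡0  3∣b = ∣ᵤ⇒∣ 3∣b
  3∣b[reduce] c≡0  3∣c = ∣ᵤ⇒∣ 3∣c
  3∣b[reduce] b≡-c {a} {b} {c} {d} 3∣b+c =
    subst (+ 3 ∣ₛ_) (Sℤ.Ops.prove (a ∷ b ∷ c ∷ d ∷ []) (y₁ ⊕ y₂ ⊕ (y₃ ⊖ y₂) ⊗ Κ (+ 3))
                       (Cubic.b (shearE (Κ ℤ.-1ℤ) (cubic y₀ y₁ y₂ y₃))) refl)
      (∣m∣n⇒∣m+n (∣ᵤ⇒∣ {i = b ℤ.+ c} 3∣b+c) (divides (d ℤ.- c) refl))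
  3∣b[reduce] b≡c {a} {b} {c} {d} 3∣b-c =
    subst (+ 3 ∣ₛ_) (Sℤ.Ops.prove (a ∷ b ∷ c ∷ d ∷ []) (y₁ ⊖ y₂ ⊕ (y₃ ⊕ y₂) ⊗ Κ (+ 3))
                       (Cubic.b (shearE (Κ ℤ.1ℤ) (cubic y₀ y₁ y₂ y₃))) refl)
      (∣m∣n⇒∣m+n (∣ᵤ⇒∣ {i = b ℤ.- c} 3∣b-c) (divides (d ℤ.+ c) refl))

3∣m*n⇒3∣m⊎3∣n : ∀ m n → + 3 ∣ₛ m ℤ.* n → + 3 ∣ₛ m ⊎ + 3 ∣ₛ n
3∣m*n⇒3∣m⊎3∣n m n 3∣mn = Sum.map ∣ᵤ⇒∣ ∣ᵤ⇒∣
  (euclidsLemma ℤ.∣ m ∣ ℤ.∣ n ∣ (toWitness {a? = prime? 3} tt)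
    (subst (3 ℕ∣_) (ℤP.abs-* m n) (∣⇒∣ᵤ 3∣mn)))

3∣u³⇒3∣u : ∀ u → + 3 ∣ₛ u ℤ.* u ℤ.* u → + 3 ∣ₛ u
3∣u³⇒3∣u u 3∣u³ =
  Sum.[ (λ 3∣u² → Sum.reduce (3∣m*n⇒3∣m⊎3∣n u u 3∣u²)) , id ]′ (3∣m*n⇒3∣m⊎3∣n (u ℤ.* u) u 3∣u³)

9∣4m⇒9∣m : ∀ m → + 9 ∣ₛ + 4 ℤ.* m → + 9 ∣ₛ m
9∣4m⇒9∣m m (divides q 4m≡9q) = divides (m ℤ.- + 2 ℤ.* q) (begin
  m                                      ≡⟨ split m ⟩
  m ℤ.* + 9 ℤ.- + 2 ℤ.* (+ 4 ℤ.* m)      ≡⟨ cong (λ z → m ℤ.* + 9 ℤ.- + 2 ℤ.* z) 4m≡9q ⟩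
  m ℤ.* + 9 ℤ.- + 2 ℤ.* (q ℤ.* + 9)      ≡⟨ collect m q ⟩
  (m ℤ.- + 2 ℤ.* q) ℤ.* + 9              ∎)
  where
  open ≡-Reasoning
  split : ∀ m → m ≡ m ℤ.* + 9 ℤ.- + 2 ℤ.* (+ 4 ℤ.* m)
  split = ℤ-Solver.solve-∀
  collect : ∀ m q → m ℤ.* + 9 ℤ.- + 2 ℤ.* (q ℤ.* + 9) ≡ (m ℤ.- + 2 ℤ.* q) ℤ.* + 9
  collect = ℤ-Solver.solve-∀

9∤fundamental : ∀ {D} → FundamentalDiscriminant D → ¬ (+ 9 ∣ₛ D)
9∤fundamental (inj₁ (_ , _ , squarefree)) 9∣D with squarefree (+ 3) (∣⇒∣ᵤ 9∣D)
... | ()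
9∤fundamental (inj₂ (m , refl , _ , squarefree)) 9∣4m with squarefree (+ 3) (∣⇒∣ᵤ (9∣4m⇒9∣m m 9∣4m))
... | ()

3∣c⇒9∣disc[a,3B,c,d] : ∀ a B c d → + 3 ∣ₛ c → + 9 ∣ₛ disc a (B ℤ.* + 3) c d
3∣c⇒9∣disc[a,3B,c,d] a B _ d (divides C refl) =
  divides (⟦ q ⟧ℤ ρ) (Sℤ.Ops.prove ρ (discE (cubic y₀ (y₁ ⊗ Κ (+ 3)) (y₂ ⊗ Κ (+ 3)) y₃)) (q ⊗ Κ (+ 9)) refl)
  where
  ρ : Vec ℤ 4
  ρ = a ∷ B ∷ C ∷ d ∷ []
  q : Expr ℤ 4
  q = Κ (+ 9) ⊗ y₁ ⊗ y₁ ⊗ y₂ ⊗ y₂ ⊖ Κ (+ 12) ⊗ y₀ ⊗ y₂ ⊗ y₂ ⊗ y₂ ⊖ Κ (+ 12) ⊗ y₁ ⊗ y₁ ⊗ y₁ ⊗ y₃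
        ⊖ Κ (+ 3) ⊗ y₀ ⊗ y₀ ⊗ y₃ ⊗ y₃ ⊕ Κ (+ 18) ⊗ y₀ ⊗ y₁ ⊗ y₂ ⊗ y₃

3∣disc[a,3B,c,d]+ac³ : ∀ a B c d → + 3 ∣ₛ disc a (B ℤ.* + 3) c d ℤ.+ a ℤ.* (c ℤ.* c ℤ.* c)
3∣disc[a,3B,c,d]+ac³ a B c d =
  divides (⟦ q ⟧ℤ ρ) (Sℤ.Ops.prove ρ (discE (cubic y₀ (y₁ ⊗ Κ (+ 3)) y₂ y₃) ⊕ y₀ ⊗ (y₂ ⊗ y₂ ⊗ y₂))
                                   (q ⊗ Κ (+ 3)) refl)
  where
  ρ : Vec ℤ 4
  ρ = a ∷ B ∷ c ∷ d ∷ []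
  q : Expr ℤ 4
  q = Κ (+ 3) ⊗ y₁ ⊗ y₁ ⊗ y₂ ⊗ y₂ ⊖ y₀ ⊗ y₂ ⊗ y₂ ⊗ y₂ ⊖ Κ (+ 36) ⊗ y₁ ⊗ y₁ ⊗ y₁ ⊗ y₃
        ⊖ Κ (+ 9) ⊗ y₀ ⊗ y₀ ⊗ y₃ ⊗ y₃ ⊕ Κ (+ 18) ⊗ y₀ ⊗ y₁ ⊗ y₂ ⊗ y₃

3∣b⇒3∣a : ∀ F → FundamentalDiscriminant (discriminant F) → + 3 ∣ₛ discriminant F →
          + 3 ∣ₛ Cubic.b F → + 3 ∣ₛ Cubic.a F
3∣b⇒3∣a (cubic a _ c d) fundamental 3∣Δ (divides B refl) =
  Sum.[ id , (λ 3∣c³ → ⊥-elim (9∤fundamental fundamental (3∣c⇒9∣disc[a,3B,c,d] a B c d (3∣u³⇒3∣u c 3∣c³)))) ]′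
    (3∣m*n⇒3∣m⊎3∣n a (c ℤ.* c ℤ.* c)
      (∣m+n∣m⇒∣n {m = disc a (B ℤ.* + 3) c d} (3∣disc[a,3B,c,d]+ac³ a B c d) 3∣Δ))

factor-3 : ∀ {a b c d} → + 3 ∣ₛ a → + 3 ∣ₛ b →
  Σ ℤ λ p₀ → Σ ℤ λ p₁ → cubic a b c d ≡ cubic (p₀ ℤ.* + 3) (p₁ ℤ.* + 3) c d
factor-3 (divides p₀ refl) (divides p₁ refl) = p₀ , p₁ , refl

reduce-normalForm : ∀ k {a b c d} → CaseCond k b c →
  FundamentalDiscriminant (disc a b c d) → + 3 ∣ disc a b c d →
  let G = reduce k (cubic a b c d) in
  Σ ℤ λ p₀ → Σ ℤ λ p₁ → G ≡ cubic (p₀ ℤ.* + 3) (p₁ ℤ.* + 3) (Cubic.c G) (Cubic.d G)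
reduce-normalForm k {a} {b} {c} {d} cond fundamental 3∣Δ =
  factor-3 (3∣b⇒3∣a G (subst FundamentalDiscriminant (sym Δ≡) fundamental)
                      (subst (+ 3 ∣ₛ_) (sym Δ≡) (∣ᵤ⇒∣ {i = disc a b c d} 3∣Δ))
                      (3∣b[reduce] k cond))
           (3∣b[reduce] k cond)
  where
  G : Cubic ℤ
  G = reduce k (cubic a b c d)
  Δ≡ : discriminant G ≡ disc a b c d
  Δ≡ = discriminant-reduce k (cubic a b c d)

record K3E (n : ℕ) : Set where
  constructor ⟪_,_,_⟫
  field e₀ e₁ e₂ : Expr ℚ n

module FieldE {n : ℕ} (F : Cubic (Expr ℚ n)) where
  open Cubic F renaming (a to A; b to B; c to C; d to D)

  one αE βE : K3E n
  one = ⟪ Κ ℚ.1ℚ , Κ ℚ.0ℚ , Κ ℚ.0ℚ ⟫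
  αE  = ⟪ Κ ℚ.0ℚ , Κ ℚ.1ℚ , Κ ℚ.0ℚ ⟫
  βE  = ⟪ Κ ℚ.0ℚ , Κ ℚ.0ℚ , Κ ℚ.1ℚ ⟫

  infixl 6 _⊕K_
  infixr 7 _·K_
  _⊕K_ : K3E n → K3E n → K3E n
  ⟪ r , s , t ⟫ ⊕K ⟪ r′ , s′ , t′ ⟫ = ⟪ r ⊕ r′ , s ⊕ s′ , t ⊕ t′ ⟫

  _·K_ : Expr ℚ n → K3E n → K3E n
  q ·K ⟪ r , s , t ⟫ = ⟪ q ⊗ r , q ⊗ s , q ⊗ t ⟫

  _⊗K_ : K3E n → K3E n → K3E n
  ⟪ r , s , t ⟫ ⊗K ⟪ r′ , s′ , t′ ⟫ =
    ⟪ r ⊗ r′ ⊖ A ⊗ C ⊗ (s ⊗ s′) ⊖ A ⊗ D ⊗ (s ⊗ t′ ⊕ t ⊗ s′) ⊖ B ⊗ D ⊗ (t ⊗ t′)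
    , r ⊗ s′ ⊕ s ⊗ r′ ⊕ B ⊗ (s ⊗ s′) ⊕ D ⊗ (t ⊗ t′)
    , r ⊗ t′ ⊕ t ⊗ r′ ⊖ A ⊗ (s ⊗ s′) ⊖ C ⊗ (t ⊗ t′) ⟫

  trE : K3E n → Expr ℚ n
  trE x = K3E.e₀ (x ⊗K one) ⊕ K3E.e₁ (x ⊗K αE) ⊕ K3E.e₂ (x ⊗K βE)

  α₀E β₀E : K3E n
  α₀E = αE ⊕K (⊝ (trE αE ⊗ Κ (+ 1 ℚ./ 3))) ·K one
  β₀E = βE ⊕K (⊝ (trE βE ⊗ Κ (+ 1 ℚ./ 3))) ·K one

  basis₁E basis₂E : Case → K3E n
  basis₁E b≡0  = α₀E
  basis₁E c≡0  = Κ (+ 3 ℚ./ 1) ·K α₀E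
  basis₁E b≡-c = α₀E ⊕K Κ (ℚ.- ℚ.1ℚ) ·K β₀E
  basis₁E b≡c  = α₀E ⊕K β₀E
  basis₂E b≡0  = Κ (+ 3 ℚ./ 1) ·K β₀E
  basis₂E c≡0  = β₀E
  basis₂E b≡-c = Κ (+ 3 ℚ./ 1) ·K β₀E
  basis₂E b≡c  = Κ (+ 3 ℚ./ 1) ·K β₀E

  traceFormE : Case → (x y : Expr ℚ n) → Expr ℚ n
  traceFormE k x y = trE (v ⊗K v) ⊗ Κ (+ 1 ℚ./ 6)
    where
    v : K3E n
    v = x ·K basis₁E k ⊕K y ·K basis₂E k

open FieldE using (traceFormE)

⟦traceFormE⟧ : ∀ k a b c d x y →
  ⟦ traceFormE genericCubic k x₄ x₅ ⟧ℚ (Vec.map toℚ (a ∷ b ∷ c ∷ d ∷ x ∷ y ∷ []))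
    ≡ sixthTraceForm a b c d k x y
⟦traceFormE⟧ b≡0  a b c d x y = refl
⟦traceFormE⟧ c≡0  a b c d x y = refl
⟦traceFormE⟧ b≡-c a b c d x y = refl
⟦traceFormE⟧ b≡c  a b c d x y = refl

traceFormE-[] : ∀ k (F : Cubic (Expr ℚ 6)) →
  traceFormE genericCubic k x₄ x₅ [ Cubic.a F ∷ Cubic.b F ∷ Cubic.c F ∷ Cubic.d F ∷ x₄ ∷ x₅ ∷ [] ]
    ≡ traceFormE F k x₄ x₅
traceFormE-[] b≡0  F = refl
traceFormE-[] c≡0  F = refl
traceFormE-[] b≡-c F = refl
traceFormE-[] b≡c  F = refl

⟦substXE⟧ : ∀ k p₀ p₁ p₂ p₃ x y → ⟦ substXE k x₄ x₅ ⟧ℤ (p₀ ∷ p₁ ∷ p₂ ∷ p₃ ∷ x ∷ y ∷ []) ≡ substX k x y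
⟦substXE⟧ b≡0  _ _ _ _ _ _ = refl
⟦substXE⟧ c≡0  _ _ _ _ _ _ = refl
⟦substXE⟧ b≡-c _ _ _ _ _ _ = refl
⟦substXE⟧ b≡c  _ _ _ _ _ _ = refl

⟦substYE⟧ : ∀ k p₀ p₁ p₂ p₃ x y → ⟦ substYE k x₄ x₅ ⟧ℤ (p₀ ∷ p₁ ∷ p₂ ∷ p₃ ∷ x ∷ y ∷ []) ≡ substY k x y
⟦substYE⟧ b≡0  _ _ _ _ _ _ = refl
⟦substYE⟧ c≡0  _ _ _ _ _ _ = refl
⟦substYE⟧ b≡-c _ _ _ _ _ _ = refl
⟦substYE⟧ b≡c  _ _ _ _ _ _ = refl

weaken : ∀ {A : Set} → Expr A 4 → Expr A 6
weaken e = e [ x₀ ∷ x₁ ∷ x₂ ∷ x₃ ∷ [] ]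

instantiate : ∀ {A : Set} → Cubic (Expr A 4) → (x y : Expr A 6) → Vec (Expr A 6) 6
instantiate (cubic a b c d) x y = weaken a ∷ weaken b ∷ weaken c ∷ weaken d ∷ x ∷ y ∷ []

evalCubic : ∀ {n} → Cubic (Expr ℤ n) → Vec ℤ n → Cubic ℤ
evalCubic F ρ = mapCubic (λ e → ⟦ e ⟧ℤ ρ) F

_at_,_ : Cubic ℤ → ℤ → ℤ → Vec ℤ 6
cubic a b c d at x , y = a ∷ b ∷ c ∷ d ∷ x ∷ y ∷ []

module _ (F : Cubic (Expr ℤ 4)) (X Y : Expr ℤ 6) (p₀ p₁ p₂ p₃ x y : ℤ) where
  private
    ρ : Vec ℤ 6
    ρ = p₀ ∷ p₁ ∷ p₂ ∷ p₃ ∷ x ∷ y ∷ []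

    ⟦weaken⟧ : ∀ e → ⟦ weaken e ⟧ℤ ρ ≡ ⟦ e ⟧ℤ (p₀ ∷ p₁ ∷ p₂ ∷ p₃ ∷ [])
    ⟦weaken⟧ e = ⟦[]⟧ℤ e (x₀ ∷ x₁ ∷ x₂ ∷ x₃ ∷ []) ρ

  map-⟦instantiate⟧ : Vec.map (λ e → ⟦ e ⟧ℤ ρ) (instantiate F X Y)
                        ≡ evalCubic F (p₀ ∷ p₁ ∷ p₂ ∷ p₃ ∷ []) at ⟦ X ⟧ℤ ρ , ⟦ Y ⟧ℤ ρ
  map-⟦instantiate⟧ =
    cong₂ _∷_ (⟦weaken⟧ a) (cong₂ _∷_ (⟦weaken⟧ b) (cong₂ _∷_ (⟦weaken⟧ c)
      (cong₂ _∷_ (⟦weaken⟧ d) refl)))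
    where open Cubic F

  ⟦instantiate⟧ : ∀ M → ⟦ M [ instantiate F X Y ] ⟧ℤ ρ
                          ≡ ⟦ M ⟧ℤ (evalCubic F (p₀ ∷ p₁ ∷ p₂ ∷ p₃ ∷ []) at ⟦ X ⟧ℤ ρ , ⟦ Y ⟧ℤ ρ)
  ⟦instantiate⟧ M = trans (⟦[]⟧ℤ M (instantiate F X Y) ρ) (cong ⟦ M ⟧ℤ map-⟦instantiate⟧)

  ⟦cast-instantiate⟧ : ∀ M → ⟦ M [ Vec.map castExpr (instantiate F X Y) ] ⟧ℚ (Vec.map toℚ ρ)
    ≡ ⟦ M ⟧ℚ (Vec.map toℚ (evalCubic F (p₀ ∷ p₁ ∷ p₂ ∷ p₃ ∷ []) at ⟦ X ⟧ℤ ρ , ⟦ Y ⟧ℤ ρ))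
  ⟦cast-instantiate⟧ M = trans (⟦[]⟧ℚ M (Vec.map castExpr σ) (Vec.map toℚ ρ))
    (cong ⟦ M ⟧ℚ (trans (⟦map-castExpr⟧ σ ρ) (cong (Vec.map toℚ) map-⟦instantiate⟧)))
    where
    σ : Vec (Expr ℤ 6) 6
    σ = instantiate F X Y

GaussianReduction : Cubic ℤ → Case → Set
GaussianReduction (cubic a b c d) k =
  Σ ℤ λ a₀ → Σ ℤ λ a₁ → Σ ℤ λ a₂ → Σ ℤ λ a₃ →
    (∀ (x y : ℤ) → cubicForm a b c d (substX k x y) (substY k x y)
                     ≡ + 3 ℤ.* gaussianForm a₀ a₁ a₂ a₃ x y)
    × (disc a₀ (+ 3 ℤ.* a₁) (+ 3 ℤ.* a₂) a₃ ≡ + 9 ℤ.* disc a b c d)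
    × SL₂-equivalent (φ₁ a₀ a₁ a₂ a₃) (sixthTraceForm a b c d k)

≡⇒SL₂-equivalent : ∀ Φ g → (∀ x y → g x y ≡ toℚ (Φ x y)) → SL₂-equivalent Φ g
≡⇒SL₂-equivalent Φ g g≡Φ =
  + 1 , + 0 , + 0 , + 1 , refl ,
  λ x y → trans (g≡Φ x y) (cong toℚ (cong₂ Φ (row₁ x y) (row₂ x y)))
  where
  row₁ : ∀ x y → x ≡ + 1 ℤ.* x ℤ.+ + 0 ℤ.* y
  row₁ = ℤ-Solver.solve-∀
  row₂ : ∀ x y → y ≡ + 0 ℤ.* x ℤ.+ + 1 ℤ.* y
  row₂ = ℤ-Solver.solve-∀

module _ (F G : Cubic (Expr ℤ 4)) (p₀ p₁ p₂ p₃ : ℤ) where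
  private
    F⁺ G⁺ : Cubic (Expr ℤ 6)
    F⁺ = mapCubic weaken F
    G⁺ = mapCubic weaken G
    p : Vec ℤ 4
    p = p₀ ∷ p₁ ∷ p₂ ∷ p₃ ∷ []
    ρ : ℤ → ℤ → Vec ℤ 6
    ρ x y = p₀ ∷ p₁ ∷ p₂ ∷ p₃ ∷ x ∷ y ∷ []
  open Cubic (evalCubic F p)
  open Cubic (evalCubic G p) renaming (a to a₀; b to a₁; c to a₂; d to a₃)
  open ≡-Reasoning

  substitution-by-identity : ∀ k →
    cubicE F⁺ (substXE k x₄ x₅) (substYE k x₄ x₅) ≐ℤ Κ (+ 3) ⊗ cubicE (gaussianCoefficients G⁺) x₄ x₅ →
    ∀ x y → cubicForm a b c d (substX k x y) (substY k x y) ≡ + 3 ℤ.* gaussianForm a₀ a₁ a₂ a₃ x y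
  substitution-by-identity k identity x y = begin
    cubicForm a b c d (substX k x y) (substY k x y)
      ≡⟨ cong₂ (λ X′ Y′ → ⟦ cubicE genericCubic x₄ x₅ ⟧ℤ (evalCubic F p at X′ , Y′))
           (⟦substXE⟧ k p₀ p₁ p₂ p₃ x y) (⟦substYE⟧ k p₀ p₁ p₂ p₃ x y) ⟨
    ⟦ cubicE genericCubic x₄ x₅ ⟧ℤ (evalCubic F p at ⟦ X ⟧ℤ (ρ x y) , ⟦ Y ⟧ℤ (ρ x y))
      ≡⟨ ⟦instantiate⟧ F X Y p₀ p₁ p₂ p₃ x y (cubicE genericCubic x₄ x₅) ⟨
    ⟦ cubicE F⁺ X Y ⟧ℤ (ρ x y)
      ≡⟨ ≐ℤ-sound identity (ρ x y) ⟩
    + 3 ℤ.* ⟦ cubicE (gaussianCoefficients G⁺) x₄ x₅ ⟧ℤ (ρ x y)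
      ≡⟨ cong (+ 3 ℤ.*_) (⟦instantiate⟧ G x₄ x₅ p₀ p₁ p₂ p₃ x y
                            (cubicE (gaussianCoefficients genericCubic) x₄ x₅)) ⟩
    + 3 ℤ.* gaussianForm a₀ a₁ a₂ a₃ x y ∎
    where
    X Y : Expr ℤ 6
    X = substXE k x₄ x₅
    Y = substYE k x₄ x₅

  discriminant-by-identity :
    discE (gaussianCoefficients G⁺) ≐ℤ Κ (+ 9) ⊗ discE F⁺ →
    disc a₀ (+ 3 ℤ.* a₁) (+ 3 ℤ.* a₂) a₃ ≡ + 9 ℤ.* disc a b c d
  discriminant-by-identity identity = begin
    disc a₀ (+ 3 ℤ.* a₁) (+ 3 ℤ.* a₂) a₃
      ≡⟨ ⟦instantiate⟧ G x₄ x₅ p₀ p₁ p₂ p₃ (+ 0) (+ 0) (discE (gaussianCoefficients genericCubic)) ⟨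
    ⟦ discE (gaussianCoefficients G⁺) ⟧ℤ (ρ (+ 0) (+ 0))
      ≡⟨ ≐ℤ-sound identity (ρ (+ 0) (+ 0)) ⟩
    + 9 ℤ.* ⟦ discE F⁺ ⟧ℤ (ρ (+ 0) (+ 0))
      ≡⟨ cong (+ 9 ℤ.*_) (⟦instantiate⟧ F x₄ x₅ p₀ p₁ p₂ p₃ (+ 0) (+ 0) (discE genericCubic)) ⟩
    + 9 ℤ.* disc a b c d ∎

  traceForm-by-identity : ∀ k →
    traceFormE (mapCubic castExpr F⁺) k x₄ x₅ ≐ℚ castExpr (φ₁E G⁺ x₄ x₅) →
    ∀ x y → sixthTraceForm a b c d k x y ≡ toℚ (φ₁ a₀ a₁ a₂ a₃ x y)
  traceForm-by-identity k identity x y = begin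
    sixthTraceForm a b c d k x y
      ≡⟨ ⟦traceFormE⟧ k a b c d x y ⟨
    ⟦ traceFormE genericCubic k x₄ x₅ ⟧ℚ (Vec.map toℚ (evalCubic F p at x , y))
      ≡⟨ ⟦cast-instantiate⟧ F x₄ x₅ p₀ p₁ p₂ p₃ x y (traceFormE genericCubic k x₄ x₅) ⟨
    ⟦ traceFormE genericCubic k x₄ x₅ [ Vec.map castExpr (instantiate F x₄ x₅) ] ⟧ℚ ρℚ
      ≡⟨ cong (λ e → ⟦ e ⟧ℚ ρℚ) (traceFormE-[] k (mapCubic castExpr F⁺)) ⟩
    ⟦ traceFormE (mapCubic castExpr F⁺) k x₄ x₅ ⟧ℚ ρℚ
      ≡⟨ ≐ℚ-sound identity ρℚ ⟩
    ⟦ castExpr (φ₁E G⁺ x₄ x₅) ⟧ℚ ρℚ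
      ≡⟨ ⟦castExpr⟧ (φ₁E G⁺ x₄ x₅) (ρ x y) ⟩
    toℚ (⟦ φ₁E G⁺ x₄ x₅ ⟧ℤ (ρ x y))
      ≡⟨ cong toℚ (⟦instantiate⟧ G x₄ x₅ p₀ p₁ p₂ p₃ x y (φ₁E genericCubic x₄ x₅)) ⟩
    toℚ (φ₁ a₀ a₁ a₂ a₃ x y) ∎
    where
    ρℚ : Vec ℚ 6
    ρℚ = Vec.map toℚ (ρ x y)

  gaussianReduction-by-identities : ∀ k →
    cubicE F⁺ (substXE k x₄ x₅) (substYE k x₄ x₅) ≐ℤ Κ (+ 3) ⊗ cubicE (gaussianCoefficients G⁺) x₄ x₅ →
    discE (gaussianCoefficients G⁺) ≐ℤ Κ (+ 9) ⊗ discE F⁺ →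
    traceFormE (mapCubic castExpr F⁺) k x₄ x₅ ≐ℚ castExpr (φ₁E G⁺ x₄ x₅) →
    GaussianReduction (evalCubic F p) k
  gaussianReduction-by-identities k substitution discriminant traceForm =
    a₀ , a₁ , a₂ , a₃ , substitution-by-identity k substitution , discriminant-by-identity discriminant ,
    ≡⇒SL₂-equivalent (φ₁ a₀ a₁ a₂ a₃) (sixthTraceForm a b c d k) (traceForm-by-identity k traceForm)

normalForm : Cubic (Expr ℤ 4)
normalForm = cubic (y₀ ⊗ Κ (+ 3)) (y₁ ⊗ Κ (+ 3)) y₂ y₃

-- With reduce k F = (3p₀, 3p₁, p₂, p₃) = G, the substitution of case k turns F into
-- G(x, 3y) (into G(y, 3x) when 3 ∣ c), which is 3 times the Gaussian form below.
opaque
  unfolding shear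

  expand-gaussianReduction : ∀ k p₀ p₁ p₂ p₃ →
    GaussianReduction (expand k (cubic (p₀ ℤ.* + 3) (p₁ ℤ.* + 3) p₂ p₃)) k
  expand-gaussianReduction b≡0 p₀ p₁ p₂ p₃ =
    gaussianReduction-by-identities normalForm (cubic y₀ y₁ y₂ (Κ (+ 9) ⊗ y₃)) p₀ p₁ p₂ p₃ b≡0
      (ℤ-normalisation refl) (ℤ-normalisation refl) (ℚ-normalisation refl)
  expand-gaussianReduction c≡0 p₀ p₁ p₂ p₃ =
    gaussianReduction-by-identities (reverse normalForm) (cubic (Κ (+ 9) ⊗ y₃) y₂ y₁ y₀) p₀ p₁ p₂ p₃ c≡0
      (ℤ-normalisation refl) (ℤ-normalisation refl) (ℚ-normalisation refl)
  expand-gaussianReduction b≡-c p₀ p₁ p₂ p₃ =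
    gaussianReduction-by-identities (shearE (Κ (ℤ.- ℤ.-1ℤ)) normalForm) (cubic y₀ y₁ y₂ (Κ (+ 9) ⊗ y₃))
      p₀ p₁ p₂ p₃ b≡-c (ℤ-normalisation refl) (ℤ-normalisation refl) (ℚ-normalisation refl)
  expand-gaussianReduction b≡c p₀ p₁ p₂ p₃ =
    gaussianReduction-by-identities (shearE (Κ (ℤ.- ℤ.1ℤ)) normalForm) (cubic y₀ y₁ y₂ (Κ (+ 9) ⊗ y₃))
      p₀ p₁ p₂ p₃ b≡c (ℤ-normalisation refl) (ℤ-normalisation refl) (ℚ-normalisation refl)

theorem6p4 : (a b c d : ℤ) →
    Irreducible a b c d →
    FundamentalDiscriminant (disc a b c d) →
    (+ 3) ∣ disc a b c d →
    (k : Case) → CaseCond k b c →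
    Σ ℤ λ a₀ → Σ ℤ λ a₁ → Σ ℤ λ a₂ → Σ ℤ λ a₃ →
      (∀ (x y : ℤ) → cubicForm a b c d (substX k x y) (substY k x y)
                       ≡ + 3 ℤ.* gaussianForm a₀ a₁ a₂ a₃ x y)
      × (disc a₀ (+ 3 ℤ.* a₁) (+ 3 ℤ.* a₂) a₃ ≡ + 9 ℤ.* disc a b c d)
      × SL₂-equivalent (φ₁ a₀ a₁ a₂ a₃) (sixthTraceForm a b c d k)
theorem6p4 a b c d _ fundamental 3∣Δ k cond =
  let p₀ , p₁ , G≡ = reduce-normalForm k cond fundamental 3∣Δ
      G = reduce k (cubic a b c d)
      F≡ : expand k (cubic (p₀ ℤ.* + 3) (p₁ ℤ.* + 3) (Cubic.c G) (Cubic.d G)) ≡ cubic a b c d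
      F≡ = trans (cong (expand k) (sym G≡)) (expand-reduce k (cubic a b c d))
  in subst (λ F → GaussianReduction F k) F≡
       (expand-gaussianReduction k p₀ p₁ (Cubic.c G) (Cubic.d G))
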